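{- For every $n\geq 1$ and every $P\in\mathcal{D}_n^{h,\geq}$, $$\#DUU(P)=\#UF^+D(\phi(P))+\#UD(\phi(P))+\delta_{F^n}(\phi(P))-1,$$ where $\delta_{F^n}(Q)=1$ if $Q=F^n$ and $\delta_{F^n}(Q)=0$ otherwise.
   Context: A Motzkin path of length $n$ is a word in the steps $U=(1,1)$, $D=(1,-1)$, $F=(1,0)$ forming a lattice path from $(0,0)$ to $(n,0)$ never going below the $x$-axis; $\mathcal{M}_n$ is the set of them. A Dyck path of semilength $n$ is a Motzkin path of length $2n$ without $F$ steps. Every nonempty Dyck path has a unique first return decomposition $P=U\alpha D\beta$ with $\alpha,\beta$ Dyck paths; $h$ denotes maximal height. $\mathcal{D}^{h,\geq}$ is defined recursively: it contains the empty path $\epsilon$, and $P=U\alpha D\beta$ belongs to it iff $\alpha,\beta\in\mathcal{D}^{h,\geq}$ and $h(U\alpha D)\geq h(\beta)$; $\mathcal{D}_n^{h,\geq}$ is the subset of semilength $n$. The bijection $\phi:\mathcal{D}_n^{h,\geq}\to\mathcal{M}_n$ is defined by $\phi(\epsilon)=\epsilon$, $\phi(\alpha UD)=\phi(\alpha)F$, $\phi(\alpha UU\beta D\gamma D)=\phi(\alpha)\phi(\gamma)U\phi(\beta)D$. For a word $X$, $\#X(P)$ is the number of occurrences of $X$ as consecutive steps in $P$. For words $Y,Z$ and a step $S$, $\#YS^+Z(P)=\sum_{k\geq 1}\#YS^kZ(P)$, where $S^k$ is $k$ consecutive copies of $S$. -}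

module Defs where

open import Data.Nat using (ℕ; zero; suc; _+_; _∸_; _⊔_; _≥_)
open import Data.Bool using (Bool; true; false; _∧_)
open import Data.List using (List; []; _∷_; _++_; length; reverse; replicate; map; upTo)
open import Data.List.Properties using (≡-dec)
open import Data.Nat.ListAction using (sum)
open import Data.Product using (_×_; _,_)
open import Data.Maybe using (Maybe; just; nothing)
open import Relation.Binary.PropositionalEquality using (_≡_; refl)
open import Relation.Nullary using (Dec; yes; no)

data Step : Set where
  U D F : Step

Word : Set
Word = List Step

stepEq : Step → Step → Bool
stepEq U U = true
stepEq D D = true
stepEq F F = true
stepEq _ _ = false

height-from : ℕ → Word → ℕ
height-from c []      = c
height-from c (U ∷ w) = c ⊔ height-from (suc c) w
height-from c (D ∷ w) = c ⊔ height-from (c ∸ 1) w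
height-from c (F ∷ w) = c ⊔ height-from c w

h : Word → ℕ
h = height-from 0

-- The family D^{h,≥}, via the first return decomposition P = U α D β.
-- (Every member is automatically a Dyck path, so the decomposition is the
-- first return decomposition.)

data Dhge : Word → Set where
  ε    : Dhge []
  cons : ∀ {α β} → Dhge α → Dhge β → h (U ∷ α ++ D ∷ []) ≥ h β →
         Dhge (U ∷ α ++ D ∷ β)

Dhge[_] : ℕ → Word → Set
Dhge[ n ] P = Dhge P × length P ≡ n + n

-- Matching a step `op` with its partner `cl`: given the word after an
-- opening `op`, return (inner , rest) where the word is inner ++ cl ∷ rest
-- and inner is balanced.

addM : Step → Maybe (Word × Word) → Maybe (Word × Word)
addM y (just (a , b)) = just (y ∷ a , b)
addM y nothing        = nothing

match : Step → Step → ℕ → Word → Maybe (Word × Word)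
match op cl d [] = nothing
match op cl d (x ∷ w) with stepEq x cl | stepEq x op | d
... | true  | _     | zero   = just ([] , w)
... | true  | _     | suc d' = addM x (match op cl d' w)
... | false | true  | _      = addM x (match op cl (suc d) w)
... | false | false | _      = addM x (match op cl d w)

-- The bijection φ, by recursion on the last arch of P:
--   φ(ε) = ε,  φ(α U D) = φ(α) F,
--   φ(α U U β D γ D) = φ(α) φ(γ) U φ(β) D.
-- Implemented with fuel (the length of P, which always suffices since every
-- recursive call is on a strictly shorter word).

φ-fuel : ℕ → Word → Word
φ-fuel zero    _ = []
φ-fuel (suc k) P = go (reverse P)
  where
  -- last arch: reverse P = D ∷ reverse(α') ++ U ∷ reverse α, P = α U α' D
  inner : Word → Word → Word
  inner α [] = φ-fuel k α ++ F ∷ []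
  inner α (U ∷ t) with match U D 0 t
  ... | just (β , γ) = φ-fuel k α ++ φ-fuel k γ ++ U ∷ φ-fuel k β ++ D ∷ []
  ... | nothing      = []
  inner α _ = []

  go : Word → Word
  go [] = []
  go (D ∷ r) with match D U 0 r
  ... | just (a'r , αr) = inner (reverse αr) (reverse a'r)
  ... | nothing         = []
  go _ = []

φ : Word → Word
φ P = φ-fuel (length P) P

isPrefix : Word → Word → Bool
isPrefix []      _       = true
isPrefix (_ ∷ _) []      = false
isPrefix (x ∷ X) (y ∷ w) = stepEq x y ∧ isPrefix X w

indicator : Bool → ℕ
indicator true  = 1
indicator false = 0

occ : Word → Word → ℕ
occ X []      = 0
occ X (y ∷ w) = indicator (isPrefix X (y ∷ w)) + occ X w

-- #U F^+ D(Q) = Σ_{k ≥ 1} #U F^k D(Q); terms with k > length Q vanish,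
-- so the sum is taken over k = 1 .. length Q.
occUF+D : Word → ℕ
occUF+D Q = sum (map (λ j → occ (U ∷ replicate (suc j) F ++ D ∷ []) Q) (upTo (length Q)))

stepDec : (x y : Step) → Dec (x ≡ y)
stepDec U U = yes refl
stepDec D D = yes refl
stepDec F F = yes refl
stepDec U D = no (λ ())
stepDec U F = no (λ ())
stepDec D U = no (λ ())
stepDec D F = no (λ ())
stepDec F U = no (λ ())
stepDec F D = no (λ ())

δF : ℕ → Word → ℕ
δF n Q with ≡-dec stepDec Q (replicate n F)
... | yes _ = 1
... | no  _ = 0

{-# OPTIONS --safe #-}
module Submission where

open import Defs
open import Data.Bool using (Bool; true; false)
open import Data.Empty using (⊥; ⊥-elim)
open import Data.List using ([]; _∷_; _++_; _∷ʳ_; reverse; length; replicate; applyUpTo; map; upTo)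
open import Data.List.Properties
  using ( ++-assoc; ++-identityʳ; reverse-++; unfold-reverse; reverse-involutive; length-++
        ; map-applyUpTo; ≡-dec)
open import Data.Maybe using (just)
open import Data.Nat using (ℕ; zero; suc; _+_; _≤_; _<_; _≥_)
open import Data.Nat.ListAction using (sum)
open import Data.Nat.Properties
open import Data.Nat.Tactic.RingSolver using (solve-∀)
open import Data.Product using (_,_)
open import Function using (_∘_; id)
open import Relation.Binary.PropositionalEquality
open import Relation.Nullary using (yes; no)

-- Split P ∈ D^{h,≥} at its first return, P = U α D δ.  If α = ε then h(δ) ≤ h(UD) = 1
-- forces δ = (UD)^k, and φ(P) = F φ(δ) changes neither side.  If α = U β D γ then
-- φ(P) = φ(γ) U φ(β) D φ(δ) is a concatenation of Motzkin paths, so its flat arches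
-- U F^k D (k ≥ 0) are those of the pieces plus the new arch when φ(β) = F^*, i.e. when
-- β = (UD)^*; every occurrence of DUU in P lies in β, in D γ or in D δ.
-- These two counts match because on D^{h,≥} the word D Q contains as many DUU as φ(Q)
-- has flat arches: Q starts with UU exactly when it is not of the form (UD)^k.
-- Finally #UF⁺D + #UD counts the flat arches, and δ_{F^n}(φ P) = 1 iff P = (UD)^n.

data Balanced (o c : Step) : Word → Set where
  []    : Balanced o c []
  arch  : ∀ {a b} → Balanced o c a → Balanced o c b → Balanced o c (o ∷ a ++ c ∷ b)

Dyck : Word → Set
Dyck = Balanced U D

Balanced-++ : ∀ {o c a b} → Balanced o c a → Balanced o c b → Balanced o c (a ++ b)
Balanced-++ [] q = q
Balanced-++ {c = c} {b = b′} (arch {a} {b} p p′) q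
  rewrite ++-assoc a (c ∷ b) b′ = arch p (Balanced-++ p′ q)

reverse-arch : ∀ (o c : Step) a b → reverse (o ∷ a ++ c ∷ b) ≡ reverse b ++ c ∷ reverse a ++ o ∷ []
reverse-arch o c a b = begin
  reverse (o ∷ a ++ c ∷ b)             ≡⟨ unfold-reverse o (a ++ c ∷ b) ⟩
  reverse (a ++ c ∷ b) ∷ʳ o            ≡⟨ cong (_∷ʳ o) (reverse-++ a (c ∷ b)) ⟩
  (reverse (c ∷ b) ++ reverse a) ∷ʳ o  ≡⟨ cong (λ z → (z ++ reverse a) ∷ʳ o) (unfold-reverse c b) ⟩
  ((reverse b ∷ʳ c) ++ reverse a) ∷ʳ o ≡⟨ ++-assoc (reverse b ∷ʳ c) (reverse a) (o ∷ []) ⟩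
  (reverse b ∷ʳ c) ++ (reverse a ∷ʳ o) ≡⟨ ++-assoc (reverse b) (c ∷ []) (reverse a ∷ʳ o) ⟩
  reverse b ++ c ∷ reverse a ++ o ∷ [] ∎
  where open ≡-Reasoning

Balanced-reverse : ∀ {o c w} → Balanced o c w → Balanced c o (reverse w)
Balanced-reverse [] = []
Balanced-reverse {o} {c} (arch {a} {b} p q) rewrite reverse-arch o c a b =
  Balanced-++ (Balanced-reverse q) (arch (Balanced-reverse p) [])

stepEq-refl : ∀ s → stepEq s s ≡ true
stepEq-refl U = refl
stepEq-refl D = refl
stepEq-refl F = refl

match-open : ∀ {o c} d r → stepEq o c ≡ false → match o c d (o ∷ r) ≡ addM o (match o c (suc d) r)
match-open {o} d r o≢c rewrite o≢c | stepEq-refl o = refl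

match-close-zero : ∀ o c r → match o c 0 (c ∷ r) ≡ just ([] , r)
match-close-zero o c r rewrite stepEq-refl c = refl

match-close-suc : ∀ o c d r → match o c (suc d) (c ∷ r) ≡ addM c (match o c d r)
match-close-suc o c d r rewrite stepEq-refl c = refl

match-balanced : ∀ {o c w x a b} d → stepEq o c ≡ false → Balanced o c w →
  match o c d x ≡ just (a , b) → match o c d (w ++ x) ≡ just (w ++ a , b)
match-balanced d o≢c [] m = m
match-balanced {o} {c} {x = x} {a′} {b′} d o≢c (arch {a} {b} p q) m = begin
  match o c d (o ∷ (a ++ c ∷ b) ++ x)           ≡⟨ cong (match o c d ∘ (o ∷_)) (++-assoc a (c ∷ b) x) ⟩
  match o c d (o ∷ a ++ c ∷ b ++ x)             ≡⟨ match-open d _ o≢c ⟩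
  addM o (match o c (suc d) (a ++ c ∷ b ++ x))  ≡⟨ cong (addM o) (match-balanced (suc d) o≢c p inner) ⟩
  just (o ∷ a ++ c ∷ b ++ a′ , b′)              ≡⟨ cong (λ z → just (o ∷ z , b′)) (++-assoc a (c ∷ b) a′) ⟨
  just (o ∷ (a ++ c ∷ b) ++ a′ , b′)            ∎
  where
  open ≡-Reasoning
  inner : match o c (suc d) (c ∷ b ++ x) ≡ just (c ∷ b ++ a′ , b′)
  inner = trans (match-close-suc o c d (b ++ x)) (cong (addM c) (match-balanced d o≢c q m))

match-closing : ∀ {o c w} r → stepEq o c ≡ false → Balanced o c w →
  match o c 0 (w ++ c ∷ r) ≡ just (w , r)
match-closing {o} {c} {w} r o≢c p =
  trans (match-balanced 0 o≢c p (match-close-zero o c r)) (cong (λ z → just (z , r)) (++-identityʳ w))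

reverse-snocArch : ∀ α α′ → reverse (α ++ U ∷ α′ ++ D ∷ []) ≡ D ∷ reverse α′ ++ U ∷ reverse α
reverse-snocArch α α′ = begin
  reverse (α ++ U ∷ α′ ++ D ∷ [])          ≡⟨ reverse-++ α (U ∷ α′ ++ D ∷ []) ⟩
  reverse (U ∷ α′ ++ D ∷ []) ++ reverse α  ≡⟨ cong (_++ reverse α) (reverse-arch U D α′ []) ⟩
  (D ∷ reverse α′ ++ U ∷ []) ++ reverse α  ≡⟨ cong (D ∷_) (++-assoc (reverse α′) (U ∷ []) (reverse α)) ⟩
  D ∷ reverse α′ ++ U ∷ reverse α          ∎
  where open ≡-Reasoning

φ-fuel-snoc-UD : ∀ k α → φ-fuel (suc k) (α ++ U ∷ D ∷ []) ≡ φ-fuel k α ++ F ∷ []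
φ-fuel-snoc-UD k α rewrite reverse-snocArch α [] | reverse-involutive α = refl

φ-fuel-snoc-UUDD : ∀ k α {β γ} → Dyck β → Dyck γ →
  φ-fuel (suc k) (α ++ U ∷ (U ∷ β ++ D ∷ γ) ++ D ∷ [])
    ≡ φ-fuel k α ++ φ-fuel k γ ++ U ∷ φ-fuel k β ++ D ∷ []
φ-fuel-snoc-UUDD k α {β} {γ} pβ pγ
  rewrite reverse-snocArch α (U ∷ β ++ D ∷ γ)
        | match-closing (reverse α) refl (Balanced-reverse (arch pβ pγ))
        | reverse-involutive α | reverse-involutive (U ∷ β ++ D ∷ γ)
        | match-closing γ refl pβ = refl

data DyckSnoc : Word → Set where
  []       : DyckSnoc []
  snocArch : ∀ {α α′} → DyckSnoc α → Dyck α′ → DyckSnoc (α ++ U ∷ α′ ++ D ∷ [])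

DyckSnoc-++ : ∀ {x y} → DyckSnoc x → DyckSnoc y → DyckSnoc (x ++ y)
DyckSnoc-++ {x} p [] rewrite ++-identityʳ x = p
DyckSnoc-++ {x} p (snocArch {α} {α′} q d)
  rewrite sym (++-assoc x α (U ∷ α′ ++ D ∷ [])) = snocArch (DyckSnoc-++ p q) d

Dyck⇒DyckSnoc : ∀ {w} → Dyck w → DyckSnoc w
Dyck⇒DyckSnoc [] = []
Dyck⇒DyckSnoc (arch {a} {b} p q)
  rewrite sym (++-assoc (U ∷ a) (D ∷ []) b) = DyckSnoc-++ (snocArch [] p) (Dyck⇒DyckSnoc q)

φ-fuel-[] : ∀ k → φ-fuel k [] ≡ []
φ-fuel-[] zero    = refl
φ-fuel-[] (suc k) = refl

length-snocArch : ∀ α α′ → length (α ++ U ∷ α′ ++ D ∷ []) ≡ suc (length α + (length α′ + 1))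
length-snocArch α α′ rewrite length-++ α {U ∷ α′ ++ D ∷ []} | length-++ α′ {D ∷ []} =
  +-suc (length α) (length α′ + 1)

snocArch-≤ˡ : ∀ α α′ {m} → length (α ++ U ∷ α′ ++ D ∷ []) ≤ suc m → length α ≤ m
snocArch-≤ˡ α α′ le rewrite length-snocArch α α′ = ≤-trans (m≤m+n (length α) _) (≤-pred le)

snocArch-≤ʳ : ∀ α α′ {m} → length (α ++ U ∷ α′ ++ D ∷ []) ≤ suc m → length α′ ≤ m
snocArch-≤ʳ α α′ le rewrite length-snocArch α α′ =
  ≤-trans (≤-trans (m≤m+n (length α′) 1) (m≤n+m _ (length α))) (≤-pred le)

snocArch-≰0 : ∀ α α′ → length (α ++ U ∷ α′ ++ D ∷ []) ≤ 0 → ⊥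
snocArch-≰0 α α′ le rewrite length-snocArch α α′ with le
... | ()

arch-≤ˡ : ∀ β γ → length β ≤ length (U ∷ β ++ D ∷ γ)
arch-≤ˡ β γ rewrite length-++ β {D ∷ γ} = m≤n⇒m≤1+n (m≤m+n (length β) _)

arch-≤ʳ : ∀ β γ → length γ ≤ length (U ∷ β ++ D ∷ γ)
arch-≤ʳ β γ rewrite length-++ β {D ∷ γ} = m≤n⇒m≤1+n (≤-trans (n≤1+n _) (m≤n+m _ (length β)))

φ-fuel-irrelevant : ∀ k j {P} → DyckSnoc P → length P ≤ k → length P ≤ j → φ-fuel k P ≡ φ-fuel j P
φ-fuel-irrelevant k j [] _ _ = trans (φ-fuel-[] k) (sym (φ-fuel-[] j))
φ-fuel-irrelevant zero j (snocArch {α} {α′} _ _) P≤0 _ = ⊥-elim (snocArch-≰0 α α′ P≤0)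
φ-fuel-irrelevant (suc k) zero (snocArch {α} {α′} _ _) _ P≤0 = ⊥-elim (snocArch-≰0 α α′ P≤0)
φ-fuel-irrelevant (suc k) (suc j) (snocArch {α} {[]} p []) P≤k P≤j
  rewrite φ-fuel-snoc-UD k α | φ-fuel-snoc-UD j α
        | φ-fuel-irrelevant k j p (snocArch-≤ˡ α [] P≤k) (snocArch-≤ˡ α [] P≤j) = refl
φ-fuel-irrelevant (suc k) (suc j) (snocArch {α} p (arch {β} {γ} pβ pγ)) P≤k P≤j = begin
  φ-fuel (suc k) (α ++ U ∷ α′ ++ D ∷ [])
    ≡⟨ φ-fuel-snoc-UUDD k α pβ pγ ⟩
  φ-fuel k α ++ φ-fuel k γ ++ U ∷ φ-fuel k β ++ D ∷ []
    ≡⟨ cong₂ (λ a g → a ++ g ++ U ∷ φ-fuel k β ++ D ∷ [])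
         (φ-fuel-irrelevant k j p (snocArch-≤ˡ α α′ P≤k) (snocArch-≤ˡ α α′ P≤j))
         (inside pγ (arch-≤ʳ β γ)) ⟩
  φ-fuel j α ++ φ-fuel j γ ++ U ∷ φ-fuel k β ++ D ∷ []
    ≡⟨ cong (λ b → φ-fuel j α ++ φ-fuel j γ ++ U ∷ b ++ D ∷ []) (inside pβ (arch-≤ˡ β γ)) ⟩
  φ-fuel j α ++ φ-fuel j γ ++ U ∷ φ-fuel j β ++ D ∷ []
    ≡⟨ φ-fuel-snoc-UUDD j α pβ pγ ⟨
  φ-fuel (suc j) (α ++ U ∷ α′ ++ D ∷ [])
    ∎
  where
  open ≡-Reasoning
  α′ = U ∷ β ++ D ∷ γ
  inside : ∀ {Q} → Dyck Q → length Q ≤ length α′ → φ-fuel k Q ≡ φ-fuel j Q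
  inside q Q≤α′ = φ-fuel-irrelevant k j (Dyck⇒DyckSnoc q)
    (≤-trans Q≤α′ (snocArch-≤ʳ α α′ P≤k)) (≤-trans Q≤α′ (snocArch-≤ʳ α α′ P≤j))

φ-snoc-UD : ∀ {α} → DyckSnoc α → φ (α ++ U ∷ D ∷ []) ≡ φ α ++ F ∷ []
φ-snoc-UD {α} p = begin
  φ-fuel (length P) P                  ≡⟨ cong (λ n → φ-fuel n P) (length-snocArch α []) ⟩
  φ-fuel (suc (length α + 1)) P        ≡⟨ φ-fuel-snoc-UD _ α ⟩
  φ-fuel (length α + 1) α ++ F ∷ []    ≡⟨ cong (_++ F ∷ []) (φ-fuel-irrelevant _ _ p (m≤m+n _ _) ≤-refl) ⟩
  φ α ++ F ∷ []                        ∎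
  where
  open ≡-Reasoning
  P = α ++ U ∷ D ∷ []

φ-snoc-UUDD : ∀ {α β γ} → DyckSnoc α → Dyck β → Dyck γ →
  φ (α ++ U ∷ (U ∷ β ++ D ∷ γ) ++ D ∷ []) ≡ φ α ++ φ γ ++ U ∷ φ β ++ D ∷ []
φ-snoc-UUDD {α} {β} {γ} p pβ pγ = begin
  φ-fuel (length P) P
    ≡⟨ cong (λ n → φ-fuel n P) (length-snocArch α α′) ⟩
  φ-fuel (suc m) P
    ≡⟨ φ-fuel-snoc-UUDD m α pβ pγ ⟩
  φ-fuel m α ++ φ-fuel m γ ++ U ∷ φ-fuel m β ++ D ∷ []
    ≡⟨ cong₂ (λ a g → a ++ g ++ U ∷ φ-fuel m β ++ D ∷ [])
         (φ-fuel-irrelevant _ _ p (m≤m+n _ _) ≤-refl)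
         (φ-fuel-irrelevant _ _ (Dyck⇒DyckSnoc pγ) (≤-trans (arch-≤ʳ β γ) α′≤m) ≤-refl) ⟩
  φ α ++ φ γ ++ U ∷ φ-fuel m β ++ D ∷ []
    ≡⟨ cong (λ b → φ α ++ φ γ ++ U ∷ b ++ D ∷ [])
         (φ-fuel-irrelevant _ _ (Dyck⇒DyckSnoc pβ) (≤-trans (arch-≤ˡ β γ) α′≤m) ≤-refl) ⟩
  φ α ++ φ γ ++ U ∷ φ β ++ D ∷ []
    ∎
  where
  open ≡-Reasoning
  α′ = U ∷ β ++ D ∷ γ
  P = α ++ U ∷ α′ ++ D ∷ []
  m = length α + (length α′ + 1)
  α′≤m : length α′ ≤ m
  α′≤m = ≤-trans (m≤m+n (length α′) 1) (m≤n+m _ (length α))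

φ-++ : ∀ {x y} → DyckSnoc x → DyckSnoc y → φ (x ++ y) ≡ φ x ++ φ y
φ-++ {x} p [] rewrite ++-identityʳ x | ++-identityʳ (φ x) = refl
φ-++ {x} p (snocArch {α} q [])
  rewrite sym (++-assoc x α (U ∷ D ∷ []))
        | φ-snoc-UD (DyckSnoc-++ p q) | φ-snoc-UD q | φ-++ p q = ++-assoc (φ x) (φ α) (F ∷ [])
φ-++ {x} p (snocArch {α} q (arch {β} {γ} pβ pγ))
  rewrite sym (++-assoc x α (U ∷ (U ∷ β ++ D ∷ γ) ++ D ∷ []))
        | φ-snoc-UUDD (DyckSnoc-++ p q) pβ pγ | φ-snoc-UUDD q pβ pγ | φ-++ p q
  = ++-assoc (φ x) (φ α) _

φ-UD∷ : ∀ {β} → Dyck β → φ (U ∷ D ∷ β) ≡ F ∷ φ β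
φ-UD∷ pβ = φ-++ (snocArch [] []) (Dyck⇒DyckSnoc pβ)

φ-UUDD∷ : ∀ {β γ δ} → Dyck β → Dyck γ → Dyck δ →
  φ (U ∷ (U ∷ β ++ D ∷ γ) ++ D ∷ δ) ≡ (φ γ ++ U ∷ φ β ++ D ∷ []) ++ φ δ
φ-UUDD∷ {β} {γ} {δ} pβ pγ pδ = begin
  φ (U ∷ α ++ D ∷ δ)          ≡⟨ cong φ (++-assoc (U ∷ α) (D ∷ []) δ) ⟨
  φ ((U ∷ α ++ D ∷ []) ++ δ)  ≡⟨ φ-++ (snocArch [] (arch pβ pγ)) (Dyck⇒DyckSnoc pδ) ⟩
  φ (U ∷ α ++ D ∷ []) ++ φ δ  ≡⟨ cong (_++ φ δ) (φ-snoc-UUDD [] pβ pγ) ⟩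
  (φ γ ++ U ∷ φ β ++ D ∷ []) ++ φ δ ∎
  where
  open ≡-Reasoning
  α = U ∷ β ++ D ∷ γ

data Motzkin : Word → Set where
  []   : Motzkin []
  flat : ∀ {w} → Motzkin w → Motzkin (F ∷ w)
  arch : ∀ {a b} → Motzkin a → Motzkin b → Motzkin (U ∷ a ++ D ∷ b)

Motzkin-++ : ∀ {a b} → Motzkin a → Motzkin b → Motzkin (a ++ b)
Motzkin-++ [] q = q
Motzkin-++ (flat p) q = flat (Motzkin-++ p q)
Motzkin-++ {b = b′} (arch {a} {b} p p′) q rewrite ++-assoc a (D ∷ b) b′ = arch p (Motzkin-++ p′ q)

allF : Word → Bool
allF []      = true
allF (F ∷ w) = allF w
allF _       = false

startsF*D : Word → Bool
startsF*D (F ∷ w) = startsF*D w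
startsF*D (D ∷ w) = true
startsF*D _       = false

startsUF*D : Word → Bool
startsUF*D (U ∷ w) = startsF*D w
startsUF*D _       = false

#UF*D : Word → ℕ
#UF*D []      = 0
#UF*D (s ∷ w) = indicator (startsUF*D (s ∷ w)) + #UF*D w

startsF*D-Motzkin-++D : ∀ {a} → Motzkin a → ∀ x → startsF*D (a ++ D ∷ x) ≡ allF a
startsF*D-Motzkin-++D []         x = refl
startsF*D-Motzkin-++D (flat p)   x = startsF*D-Motzkin-++D p x
startsF*D-Motzkin-++D (arch p q) x = refl

#UF*D-++ : ∀ {a} → Motzkin a → ∀ b → #UF*D (a ++ b) ≡ #UF*D a + #UF*D b
#UF*D-++ []       b = refl
#UF*D-++ (flat p) b = #UF*D-++ p b
#UF*D-++ (arch {a₁} {a₂} p q) b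
  rewrite ++-assoc a₁ (D ∷ a₂) b
        | startsF*D-Motzkin-++D p (a₂ ++ b) | startsF*D-Motzkin-++D p a₂
        | #UF*D-++ p (D ∷ a₂ ++ b) | #UF*D-++ p (D ∷ a₂) | #UF*D-++ q b
  = reassoc (indicator (allF a₁)) (#UF*D a₁) (#UF*D a₂) (#UF*D b)
  where
  reassoc : ∀ i a b c → i + (a + (b + c)) ≡ (i + (a + b)) + c
  reassoc = solve-∀

#UF*D-arch : ∀ {q} → Motzkin q → #UF*D (U ∷ q ++ D ∷ []) ≡ indicator (allF q) + #UF*D q
#UF*D-arch {q} p rewrite startsF*D-Motzkin-++D p [] | #UF*D-++ p (D ∷ []) | +-identityʳ (#UF*D q) = refl

Dhge⇒Dyck : ∀ {P} → Dhge P → Dyck P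
Dhge⇒Dyck ε            = []
Dhge⇒Dyck (cons p q _) = arch (Dhge⇒Dyck p) (Dhge⇒Dyck q)

φ-Motzkin : ∀ {P} → Dhge P → Motzkin (φ P)
φ-Motzkin ε = []
φ-Motzkin (cons ε q _) rewrite φ-UD∷ (Dhge⇒Dyck q) = flat (φ-Motzkin q)
φ-Motzkin (cons (cons p₁ p₂ _) q _)
  rewrite φ-UUDD∷ (Dhge⇒Dyck p₁) (Dhge⇒Dyck p₂) (Dhge⇒Dyck q)
  = Motzkin-++ (Motzkin-++ (φ-Motzkin p₂) (arch (φ-Motzkin p₁) [])) (φ-Motzkin q)

isUD* : Word → Bool
isUD* []          = true
isUD* (U ∷ D ∷ w) = isUD* w
isUD* _           = false

allF-++U : ∀ x y → allF (x ++ U ∷ y) ≡ false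
allF-++U []      y = refl
allF-++U (U ∷ x) y = refl
allF-++U (D ∷ x) y = refl
allF-++U (F ∷ x) y = allF-++U x y

allF-φ : ∀ {P} → Dhge P → allF (φ P) ≡ isUD* P
allF-φ ε = refl
allF-φ (cons ε q _) rewrite φ-UD∷ (Dhge⇒Dyck q) = allF-φ q
allF-φ (cons {_} {β} (cons {β′} {γ′} p₁ p₂ _) q _)
  rewrite φ-UUDD∷ (Dhge⇒Dyck p₁) (Dhge⇒Dyck p₂) (Dhge⇒Dyck q)
        | ++-assoc (φ γ′) (U ∷ φ β′ ++ D ∷ []) (φ β) = allF-++U (φ γ′) _

height-from-≥ : ∀ c w → c ≤ height-from c w
height-from-≥ c []      = ≤-refl
height-from-≥ c (U ∷ w) = m≤m⊔n c _
height-from-≥ c (D ∷ w) = m≤m⊔n c _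
height-from-≥ c (F ∷ w) = m≤m⊔n c _

h-UU∷ : ∀ w → 1 < h (U ∷ U ∷ w)
h-UU∷ w = ≤-trans (height-from-≥ 2 w) (m≤n⊔m 1 _)

startsUU : Word → Bool
startsUU = isPrefix (U ∷ U ∷ [])

#DUU : Word → ℕ
#DUU = occ (D ∷ U ∷ U ∷ [])

startsUU-Dyck-++D : ∀ {b} → Dyck b → ∀ x → startsUU (b ++ D ∷ x) ≡ startsUU b
startsUU-Dyck-++D []                  x = refl
startsUU-Dyck-++D (arch {[]} _ _)     x = refl
startsUU-Dyck-++D (arch {_ ∷ _} _ _)  x = refl

#DUU-Dyck-++D : ∀ {α} → Dyck α → ∀ x → #DUU (α ++ D ∷ x) ≡ #DUU α + #DUU (D ∷ x)
#DUU-Dyck-++D [] x = refl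
#DUU-Dyck-++D (arch {a} {b} p q) x
  rewrite ++-assoc a (D ∷ b) (D ∷ x) | #DUU-Dyck-++D p (b ++ D ∷ x) | #DUU-Dyck-++D p b
        | startsUU-Dyck-++D q x | #DUU-Dyck-++D q x
  = reassoc (#DUU a) (indicator (startsUU b)) (#DUU b) (#DUU (D ∷ x))
  where
  reassoc : ∀ a s b c → a + (s + (b + c)) ≡ (a + (s + b)) + c
  reassoc = solve-∀

h≤1⇒¬startsUU : ∀ β → h β ≤ 1 → startsUU β ≡ false
h≤1⇒¬startsUU []            _ = refl
h≤1⇒¬startsUU (D ∷ β)       _ = refl
h≤1⇒¬startsUU (F ∷ β)       _ = refl
h≤1⇒¬startsUU (U ∷ [])      _ = refl
h≤1⇒¬startsUU (U ∷ D ∷ β)   _ = refl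
h≤1⇒¬startsUU (U ∷ F ∷ β)   _ = refl
h≤1⇒¬startsUU (U ∷ U ∷ β) h≤1 = ⊥-elim (<⇒≱ (h-UU∷ β) h≤1)

h≤1⇒isUD* : ∀ {β} → Dhge β → h β ≤ 1 → isUD* β ≡ true
h≤1⇒isUD* ε                                _   = refl
h≤1⇒isUD* (cons ε q h≥)                    _   = h≤1⇒isUD* q h≥
h≤1⇒isUD* (cons {_} {β} (cons {a} {b} _ _ _) _ _) h≤1 =
  ⊥-elim (<⇒≱ (h-UU∷ ((a ++ D ∷ b) ++ D ∷ β)) h≤1)

startsUU+isUD*≡1 : ∀ {γ} → Dhge γ → indicator (startsUU γ) + indicator (isUD* γ) ≡ 1
startsUU+isUD*≡1 ε                        = refl
startsUU+isUD*≡1 (cons ε q h≥) rewrite h≤1⇒isUD* q h≥ = refl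
startsUU+isUD*≡1 (cons (cons _ _ _) _ _)  = refl

#DUU-UUDD∷ : ∀ {β γ} → Dyck β → Dyck γ → ∀ δ →
  #DUU (U ∷ (U ∷ β ++ D ∷ γ) ++ D ∷ δ) ≡ #DUU β + #DUU (D ∷ γ) + #DUU (D ∷ δ)
#DUU-UUDD∷ {β} {γ} pβ pγ δ =
  trans (#DUU-Dyck-++D (arch pβ pγ) δ) (cong (_+ #DUU (D ∷ δ)) (#DUU-Dyck-++D pβ γ))

#UF*D-φ-UUDD∷ : ∀ {β γ δ} → Dhge β → Dhge γ → Dhge δ →
  #UF*D (φ (U ∷ (U ∷ β ++ D ∷ γ) ++ D ∷ δ))
    ≡ #UF*D (φ γ) + (indicator (isUD* β) + #UF*D (φ β)) + #UF*D (φ δ)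
#UF*D-φ-UUDD∷ {β} {γ} {δ} pβ pγ pδ = begin
  #UF*D (φ (U ∷ (U ∷ β ++ D ∷ γ) ++ D ∷ δ))
    ≡⟨ cong #UF*D (φ-UUDD∷ (Dhge⇒Dyck pβ) (Dhge⇒Dyck pγ) (Dhge⇒Dyck pδ)) ⟩
  #UF*D ((φ γ ++ U ∷ φ β ++ D ∷ []) ++ φ δ)
    ≡⟨ #UF*D-++ (Motzkin-++ (φ-Motzkin pγ) (arch (φ-Motzkin pβ) [])) (φ δ) ⟩
  #UF*D (φ γ ++ U ∷ φ β ++ D ∷ []) + #UF*D (φ δ)
    ≡⟨ cong (_+ #UF*D (φ δ)) (#UF*D-++ (φ-Motzkin pγ) (U ∷ φ β ++ D ∷ [])) ⟩
  #UF*D (φ γ) + #UF*D (U ∷ φ β ++ D ∷ []) + #UF*D (φ δ)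
    ≡⟨ cong (λ z → #UF*D (φ γ) + z + #UF*D (φ δ)) (#UF*D-arch (φ-Motzkin pβ)) ⟩
  #UF*D (φ γ) + (indicator (allF (φ β)) + #UF*D (φ β)) + #UF*D (φ δ)
    ≡⟨ cong (λ b → #UF*D (φ γ) + (indicator b + #UF*D (φ β)) + #UF*D (φ δ)) (allF-φ pβ) ⟩
  #UF*D (φ γ) + (indicator (isUD* β) + #UF*D (φ β)) + #UF*D (φ δ)
    ∎
  where open ≡-Reasoning

mutual
  #DUU-φ : ∀ {P} → Dhge P → #DUU P + 1 ≡ #UF*D (φ P) + indicator (isUD* P)
  #DUU-φ ε = refl
  #DUU-φ (cons {_} {δ} ε q h≥) rewrite φ-UD∷ (Dhge⇒Dyck q) | h≤1⇒¬startsUU δ h≥ = #DUU-φ q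
  #DUU-φ (cons {_} {δ} (cons {β} {γ} pβ pγ _) pδ _) = begin
    #DUU P + 1
      ≡⟨ cong (_+ 1) (#DUU-UUDD∷ (Dhge⇒Dyck pβ) (Dhge⇒Dyck pγ) δ) ⟩
    #DUU β + #DUU (D ∷ γ) + #DUU (D ∷ δ) + 1
      ≡⟨ cong₂ (λ g d → #DUU β + g + d + 1) (#DUU-D∷-φ pγ) (#DUU-D∷-φ pδ) ⟩
    #DUU β + #UF*D (φ γ) + #UF*D (φ δ) + 1
      ≡⟨ reassoc (#DUU β) (#UF*D (φ γ)) (#UF*D (φ δ)) ⟩
    #UF*D (φ γ) + (#DUU β + 1) + #UF*D (φ δ)
      ≡⟨ cong (λ z → #UF*D (φ γ) + z + #UF*D (φ δ)) (trans (#DUU-φ pβ) (+-comm (#UF*D (φ β)) _)) ⟩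
    #UF*D (φ γ) + (indicator (isUD* β) + #UF*D (φ β)) + #UF*D (φ δ)
      ≡⟨ #UF*D-φ-UUDD∷ pβ pγ pδ ⟨
    #UF*D (φ P)
      ≡⟨ +-identityʳ _ ⟨
    #UF*D (φ P) + 0
      ∎
    where
    open ≡-Reasoning
    P = U ∷ (U ∷ β ++ D ∷ γ) ++ D ∷ δ
    reassoc : ∀ a g d → a + g + d + 1 ≡ g + (a + 1) + d
    reassoc = solve-∀

  #DUU-D∷-φ : ∀ {P} → Dhge P → #DUU (D ∷ P) ≡ #UF*D (φ P)
  #DUU-D∷-φ {P} p = +-cancelʳ-≡ (indicator (isUD* P)) _ _ (begin
    indicator (startsUU P) + #DUU P + indicator (isUD* P)
      ≡⟨ reassoc (indicator (startsUU P)) (#DUU P) (indicator (isUD* P)) ⟩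
    #DUU P + (indicator (startsUU P) + indicator (isUD* P))
      ≡⟨ cong (#DUU P +_) (startsUU+isUD*≡1 p) ⟩
    #DUU P + 1
      ≡⟨ #DUU-φ p ⟩
    #UF*D (φ P) + indicator (isUD* P)
      ∎)
    where
    open ≡-Reasoning
    reassoc : ∀ s a i → s + a + i ≡ a + (s + i)
    reassoc = solve-∀

sumUpTo : ℕ → (ℕ → ℕ) → ℕ
sumUpTo n f = sum (applyUpTo f n)

syntax sumUpTo n (λ j → e) = ∑[ j < n ] e

sumUpTo-0 : ∀ n {f} → (∀ j → f j ≡ 0) → sumUpTo n f ≡ 0
sumUpTo-0 zero    f≡0 = refl
sumUpTo-0 (suc n) f≡0 rewrite f≡0 0 = sumUpTo-0 n (f≡0 ∘ suc)

sumUpTo-+ : ∀ n f g → ∑[ j < n ] (f j + g j) ≡ sumUpTo n f + sumUpTo n g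
sumUpTo-+ zero    f g = refl
sumUpTo-+ (suc n) f g rewrite sumUpTo-+ n (f ∘ suc) (g ∘ suc) =
  +-assoc-comm (f 0) (g 0) (sumUpTo n (f ∘ suc)) (sumUpTo n (g ∘ suc))
  where
  +-assoc-comm : ∀ a b c d → (a + b) + (c + d) ≡ (a + c) + (b + d)
  +-assoc-comm = solve-∀

flatArch : ℕ → Word
flatArch k = U ∷ replicate k F ++ D ∷ []

∑-startsF*D : ∀ m w → length w < m →
  ∑[ k < m ] indicator (isPrefix (replicate k F ++ D ∷ []) w) ≡ indicator (startsF*D w)
∑-startsF*D m       []      _   = sumUpTo-0 m λ { zero → refl ; (suc k) → refl }
∑-startsF*D m       (U ∷ w) _   = sumUpTo-0 m λ { zero → refl ; (suc k) → refl }
∑-startsF*D (suc m) (D ∷ w) _   = cong suc (sumUpTo-0 m λ _ → refl)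
∑-startsF*D (suc m) (F ∷ w) w<m = ∑-startsF*D m w (≤-pred w<m)

∑-startsUF*D : ∀ m s w → length w < m →
  ∑[ k < m ] indicator (isPrefix (flatArch k) (s ∷ w)) ≡ indicator (startsUF*D (s ∷ w))
∑-startsUF*D m U w w<m = ∑-startsF*D m w w<m
∑-startsUF*D m D w _   = sumUpTo-0 m λ _ → refl
∑-startsUF*D m F w _   = sumUpTo-0 m λ _ → refl

∑-#flatArch : ∀ m w → length w < m → ∑[ k < m ] occ (flatArch k) w ≡ #UF*D w
∑-#flatArch m []      _ = sumUpTo-0 m λ _ → refl
∑-#flatArch m (s ∷ w) w<m = begin
  ∑[ k < m ] (indicator (isPrefix (flatArch k) (s ∷ w)) + occ (flatArch k) w)
    ≡⟨ sumUpTo-+ m _ _ ⟩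
  ∑[ k < m ] indicator (isPrefix (flatArch k) (s ∷ w)) + ∑[ k < m ] occ (flatArch k) w
    ≡⟨ cong₂ _+_ (∑-startsUF*D m s w w<m′) (∑-#flatArch m w w<m′) ⟩
  #UF*D (s ∷ w) ∎
  where
  open ≡-Reasoning
  w<m′ : length w < m
  w<m′ = <-trans (n<1+n _) w<m

occUF+D+#UD : ∀ Q → occUF+D Q + occ (U ∷ D ∷ []) Q ≡ #UF*D Q
occUF+D+#UD Q = begin
  sum (map (λ k → occ (flatArch (suc k)) Q) (upTo (length Q))) + occ (flatArch 0) Q
    ≡⟨ cong (λ z → sum z + occ (flatArch 0) Q)
            (map-applyUpTo id (λ k → occ (flatArch (suc k)) Q) (length Q)) ⟩
  ∑[ k < length Q ] occ (flatArch (suc k)) Q + occ (flatArch 0) Q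
    ≡⟨ +-comm _ (occ (flatArch 0) Q) ⟩
  ∑[ k < suc (length Q) ] occ (flatArch k) Q
    ≡⟨ ∑-#flatArch (suc (length Q)) Q ≤-refl ⟩
  #UF*D Q ∎
  where open ≡-Reasoning

δF-replicate : ∀ n → δF n (replicate n F) ≡ 1
δF-replicate n with ≡-dec stepDec (replicate n F) (replicate n F)
... | yes _  = refl
... | no neq = ⊥-elim (neq refl)

δF-≢ : ∀ n Q → Q ≢ replicate n F → δF n Q ≡ 0
δF-≢ n Q neq with ≡-dec stepDec Q (replicate n F)
... | yes eq = ⊥-elim (neq eq)
... | no _   = refl

allF-replicate : ∀ n → allF (replicate n F) ≡ true
allF-replicate zero    = refl
allF-replicate (suc n) = allF-replicate n

isUD*⇒φ≡Fⁿ : ∀ n {P} → Dhge P → isUD* P ≡ true → length P ≡ n + n → φ P ≡ replicate n F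
isUD*⇒φ≡Fⁿ zero    ε _ _ = refl
isUD*⇒φ≡Fⁿ (suc n) (cons ε q _) UD* |P|≡2n rewrite φ-UD∷ (Dhge⇒Dyck q) =
  cong (F ∷_) (isUD*⇒φ≡Fⁿ n q UD* (suc-injective (trans (suc-injective |P|≡2n) (+-suc n n))))
isUD*⇒φ≡Fⁿ zero    (cons ε _ _) _ ()
isUD*⇒φ≡Fⁿ (suc n) ε _ ()

δF-φ : ∀ n {P} → Dhge P → length P ≡ n + n → δF n (φ P) ≡ indicator (isUD* P)
δF-φ n {P} p |P|≡2n with isUD* P in UD*
... | true  = trans (cong (δF n) (isUD*⇒φ≡Fⁿ n p UD* |P|≡2n)) (δF-replicate n)
... | false = δF-≢ n (φ P) λ eq → false≢true (begin
  false                 ≡⟨ UD* ⟨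
  isUD* P               ≡⟨ allF-φ p ⟨
  allF (φ P)            ≡⟨ cong allF eq ⟩
  allF (replicate n F)  ≡⟨ allF-replicate n ⟩
  true                  ∎)
  where
  open ≡-Reasoning
  false≢true : false ≢ true
  false≢true ()

theorem5 : (n : ℕ) → n ≥ 1 → (P : Word) → Dhge[ n ] P →
    occ (D ∷ U ∷ U ∷ []) P + 1
      ≡ occUF+D (φ P) + occ (U ∷ D ∷ []) (φ P) + δF n (φ P)
theorem5 n _ P (p , |P|≡2n) = begin
  #DUU P + 1
    ≡⟨ #DUU-φ p ⟩
  #UF*D (φ P) + indicator (isUD* P)
    ≡⟨ cong₂ _+_ (occUF+D+#UD (φ P)) (δF-φ n p |P|≡2n) ⟨
  occUF+D (φ P) + occ (U ∷ D ∷ []) (φ P) + δF n (φ P)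
    ∎
  where open ≡-Reasoning
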